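{- (a) There is no $L\in\mathcal H$ such that $L=\sum_{\omega^*}L^0_i$ and $L=\sum_\omega L^1_i$ for sequences $\langle L^0_i:i\in\omega\rangle$ and $\langle L^1_i:i\in\omega\rangle$ in $\mathcal H$ satisfying condition $(*)$. (b) Let $m\in\mathbb N$, $L\in\mathcal{CS}_m$, and $L_0,\dots,L_{m-1}\in\mathcal H$ with $L=L_0+\cdots+L_{m-1}$. Then: for every $i<m$, exactly one of the following holds: $|L_i|=1$, $L_i$ is an $\omega$-sum, $L_i$ is an $\omega^*$-sum; for every $i<m-1$, $L_i+L_{i+1}\notin\mathcal H$; and whenever $|L_i|=1$, $L_{i+1}$ (if $i+1<m$) is not an $\omega$-sum and $L_{i-1}$ (if $i>0$) is not an $\omega^*$-sum.
   Context: $X\hookrightarrow Y$ means $X$ order-embeds into $Y$. $\sum_\omega L_i=L_0+L_1+\cdots$ and $\sum_{\omega^*}L_i=\cdots+L_1+L_0$. A sequence $\langle L_i:i\in\omega\rangle$ satisfies $(*)$ if for each $i$ the set $\{j:L_i\hookrightarrow L_j\}$ is infinite. $\mathcal H$ is the smallest class of order types of countable linear orders containing the one-element type and containing $\sum_\omega L_i$ and $\sum_{\omega^*}L_i$ for every sequence $\langle L_i\rangle$ in $\mathcal H$ satisfying $(*)$. An $\omega$-sum (resp. $\omega^*$-sum) is an order of the form $\sum_\omega L_i$ (resp. $\sum_{\omega^*}L_i$) for a sequence $\langle L_i\rangle$ in $\mathcal H$ satisfying $(*)$. $\mathcal{CS}$ is the class of countable scattered linear orders (those into which $\mathbb Q$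 does not embed); every $L\in\mathcal{CS}$ is a finite sum of elements of $\mathcal H$, and $m(L)$ is the least $n$ such that $L$ is a sum of $n$ elements of $\mathcal H$; $\mathcal{CS}_m=\{L\in\mathcal{CS}:m(L)=m\}$. -}

module Defs where

import Level
open import Level using (0ℓ)
open import Data.Nat using (ℕ; zero; suc; _≤_)
import Data.Nat as N
open import Data.Fin using (Fin; toℕ)
import Data.Fin as F
open import Data.Unit using (⊤; tt)
open import Data.Empty using (⊥)
open import Data.Sum using (_⊎_; inj₁; inj₂)
open import Data.Product using (Σ; ∃; _×_; _,_)
open import Relation.Nullary using (¬_)
open import Relation.Binary.PropositionalEquality using (_≡_)
open import Relation.Binary.Definitions using (Trichotomous)
open import Function.Definitions using (Injective)
open import Data.Rational using (ℚ)
import Data.Rational as Q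

-- Linearity is a separate predicate (IsLinear); every member of H is
-- automatically isomorphic to a linear order (built from 𝟙 by sums).

record RawLO : Set₁ where
  field
    Carrier : Set
    _<_     : Carrier → Carrier → Set
open RawLO public

record IsLinear (L : RawLO) : Set where
  field
    irrefl  : ∀ x → ¬ (_<_ L x x)
    trans   : ∀ {x y z} → _<_ L x y → _<_ L y z → _<_ L x z
    compare : Trichotomous _≡_ (_<_ L)

Countable : RawLO → Set
Countable L = Σ (Carrier L → ℕ) (λ f → Injective _≡_ _≡_ f)

record _↪_ (X Y : RawLO) : Set where
  field
    fun  : Carrier X → Carrier Y
    mono : ∀ {x y} → _<_ X x y → _<_ Y (fun x) (fun y)

record _≅_ (X Y : RawLO) : Set where
  field
    to      : Carrier X → Carrier Y
    from    : Carrier Y → Carrier X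
    to-from : ∀ y → to (from y) ≡ y
    from-to : ∀ x → from (to x) ≡ x
    to-mono   : ∀ {x y} → _<_ X x y → _<_ Y (to x) (to y)
    from-mono : ∀ {x y} → _<_ Y x y → _<_ X (from x) (from y)

ℚLO : RawLO
ℚLO = record { Carrier = ℚ ; _<_ = Q._<_ }

Scattered : RawLO → Set
Scattered L = ¬ (ℚLO ↪ L)

𝟙 : RawLO
𝟙 = record { Carrier = ⊤ ; _<_ = λ _ _ → ⊥ }

Singleton : RawLO → Set
Singleton L = Σ (Carrier L) (λ x → ∀ y → y ≡ x)

_⊕<_ : {X Y : RawLO} → Carrier X ⊎ Carrier Y → Carrier X ⊎ Carrier Y → Set
_⊕<_ {X} (inj₁ a) (inj₁ b) = _<_ X a b
_⊕<_ (inj₁ _) (inj₂ _) = ⊤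
_⊕<_ (inj₂ _) (inj₁ _) = ⊥
_⊕<_ {Y = Y} (inj₂ a) (inj₂ b) = _<_ Y a b

_⊕_ : RawLO → RawLO → RawLO
X ⊕ Y = record { Carrier = Carrier X ⊎ Carrier Y ; _<_ = _⊕<_ {X} {Y} }

data ωLt (Ls : ℕ → RawLO) : Σ ℕ (λ i → Carrier (Ls i)) → Σ ℕ (λ i → Carrier (Ls i)) → Set where
  diff : ∀ {i j x y} → i N.< j → ωLt Ls (i , x) (j , y)
  same : ∀ {i x y} → _<_ (Ls i) x y → ωLt Ls (i , x) (i , y)

Σω : (ℕ → RawLO) → RawLO
Σω Ls = record { Carrier = Σ ℕ (λ i → Carrier (Ls i)) ; _<_ = ωLt Ls }

data ω*Lt (Ls : ℕ → RawLO) : Σ ℕ (λ i → Carrier (Ls i)) → Σ ℕ (λ i → Carrier (Ls i)) → Set where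
  diff : ∀ {i j x y} → j N.< i → ω*Lt Ls (i , x) (j , y)
  same : ∀ {i x y} → _<_ (Ls i) x y → ω*Lt Ls (i , x) (i , y)

Σω* : (ℕ → RawLO) → RawLO
Σω* Ls = record { Carrier = Σ ℕ (λ i → Carrier (Ls i)) ; _<_ = ω*Lt Ls }

data FinLt (m : ℕ) (Ls : Fin m → RawLO) : Σ (Fin m) (λ i → Carrier (Ls i)) → Σ (Fin m) (λ i → Carrier (Ls i)) → Set where
  diff : ∀ {i j x y} → i F.< j → FinLt m Ls (i , x) (j , y)
  same : ∀ {i x y} → _<_ (Ls i) x y → FinLt m Ls (i , x) (i , y)

ΣFin : (m : ℕ) → (Fin m → RawLO) → RawLO
ΣFin m Ls = record { Carrier = Σ (Fin m) (λ i → Carrier (Ls i)) ; _<_ = FinLt m Ls }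

-- Condition (*): for each i, {j | L i ↪ L j} is infinite (unbounded).
Star : (ℕ → RawLO) → Set
Star Ls = ∀ i n → Σ ℕ (λ j → (n ≤ j) × (Ls i ↪ Ls j))

-- The class H (closed under isomorphism = order types)
data H : RawLO → Set₁ where
  one  : ∀ {L} → L ≅ 𝟙 → H L
  ωs   : ∀ {L} (Ls : ℕ → RawLO) → (∀ i → H (Ls i)) → Star Ls → L ≅ Σω Ls → H L
  ω*s  : ∀ {L} (Ls : ℕ → RawLO) → (∀ i → H (Ls i)) → Star Ls → L ≅ Σω* Ls → H L

IsωSum : RawLO → Set₁
IsωSum L = Σ (ℕ → RawLO) (λ Ls → (∀ i → H (Ls i)) × Star Ls × (L ≅ Σω Ls))

Isω*Sum : RawLO → Set₁
Isω*Sum L = Σ (ℕ → RawLO) (λ Ls → (∀ i → H (Ls i)) × Star Ls × (L ≅ Σω* Ls))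

CS : RawLO → Set
CS L = IsLinear L × Countable L × Scattered L

SumOfH : RawLO → ℕ → Set₁
SumOfH L n = Σ (Fin n → RawLO) (λ Ls → (∀ i → H (Ls i)) × (L ≅ ΣFin n Ls))

mIs : RawLO → ℕ → Set₁
mIs L m = SumOfH L m × (∀ n → n N.< m → ¬ SumOfH L n)

CSₘ : ℕ → RawLO → Set₁
CSₘ m L = CS L × mIs L m

ExactlyOne : ∀ {a b c} → Set a → Set b → Set c → Set (a Level.⊔ b Level.⊔ c)
ExactlyOne A B C = (A ⊎ B ⊎ C) × ¬ (A × B) × ¬ (A × C) × ¬ (B × C)

module Submission where

-- (a) The key fact is RIGIDITY (H-rigid): no L ∈ H has a point y together
--     with two self-embeddings, one mapping all of L strictly above y and one
--     mapping all of L strictly below y.  A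
--     self-embedding of an ω-sum Σω C with image below y stays within the
--     blocks up to that of y; descending on the highest block reached, (*)
--     then embeds Σω C into a single block C j, and such an embedding would
--     give C j a two-sided shift, contradicting the induction hypothesis.  The
--     ω*-case is the mirror image, obtained by reversing the order.  Since an
--     ω-sum shifts above and an ω*-sum shifts below any point, no member of H
--     is both.
-- (b) Each summand is a singleton, an ω-sum or an ω*-sum (the shape of H),
--     exclusively by (a) and because sums of nonempty blocks have two points.
--     Merging two adjacent summands whose sum lies in H contradicts the
--     minimality of m, and a singleton glued before an ω-sum (after an
--     ω*-sum) is again an ω-sum (ω*-sum), hence in H.

open import Defs renaming (_<_ to lt)
open import Level using (0ℓ) renaming (suc to lsuc)
open import Function using (_∘_)
open import Data.Nat using (ℕ; zero; suc; _≤_; _<_; _≤′_; ≤′-refl; ≤′-step; s≤s; z<s)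
open import Data.Nat.Properties
  using (<-irrefl; <-trans; ≤-refl; ≤-trans; ≤-antisym; <⇒≤; ≤⇒≤′; n≤0⇒n≡0; m<1+n⇒m≤n; ≤∧≢⇒<; n<1+n; n≤1+n; suc-injective)
open import Data.Fin using (Fin; toℕ; zero; suc; inject₁)
open import Data.Vec.Functional using (_∷_; tail)
open import Data.Empty using (⊥; ⊥-elim)
open import Data.Unit using (tt)
open import Data.Sum using (_⊎_; inj₁; inj₂)
open import Data.Product using (Σ; _×_; _,_; proj₁; proj₂)
open import Relation.Nullary using (¬_)
open import Relation.Binary.Bundles using (Setoid)
open import Relation.Binary.PropositionalEquality
  using (_≡_; _≢_; refl; sym; trans; cong; subst; subst₂; module ≡-Reasoning)
import Relation.Binary.Reasoning.Setoid as SetoidReasoning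

open _↪_
open _≅_

private
  variable
    X Y Z M N : RawLO
    C D : ℕ → RawLO

-- The reverse of an order; reversing twice gives back the order itself
-- definitionally (η for records).
infix 30 _ᵒᵖ
_ᵒᵖ : RawLO → RawLO
L ᵒᵖ = record { Carrier = Carrier L ; _<_ = λ x y → lt L y x }

_∘ₑ_ : Y ↪ Z → X ↪ Y → X ↪ Z
g ∘ₑ f = record { fun = fun g ∘ fun f ; mono = mono g ∘ mono f }

↪-op : X ↪ Y → X ᵒᵖ ↪ Y ᵒᵖ
↪-op f = record { fun = fun f ; mono = mono f }

≅⇒↪ : X ≅ Y → X ↪ Y
≅⇒↪ φ = record { fun = to φ ; mono = to-mono φ }

≅-refl : X ≅ X
≅-refl = record { to = λ x → x ; from = λ x → x ; to-from = λ _ → refl ; from-to = λ _ → refl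
                ; to-mono = λ h → h ; from-mono = λ h → h }

≅-sym : X ≅ Y → Y ≅ X
≅-sym φ = record { to = from φ ; from = to φ ; to-from = from-to φ ; from-to = to-from φ
                 ; to-mono = from-mono φ ; from-mono = to-mono φ }

≅-trans : X ≅ Y → Y ≅ Z → X ≅ Z
≅-trans φ ψ = record
  { to = to ψ ∘ to φ ; from = from φ ∘ from ψ
  ; to-from = λ z → trans (cong (to ψ) (to-from φ (from ψ z))) (to-from ψ z)
  ; from-to = λ x → trans (cong (from φ) (from-to ψ (to φ x))) (from-to φ x)
  ; to-mono = to-mono ψ ∘ to-mono φ ; from-mono = from-mono φ ∘ from-mono ψ }

≅-setoid : Setoid (lsuc 0ℓ) 0ℓ
≅-setoid = record { Carrier = RawLO ; _≈_ = _≅_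
                  ; isEquivalence = record { refl = ≅-refl ; sym = ≅-sym ; trans = ≅-trans } }

≅-op : X ≅ Y → X ᵒᵖ ≅ Y ᵒᵖ
≅-op φ = record { to = to φ ; from = from φ ; to-from = to-from φ ; from-to = from-to φ
                ; to-mono = to-mono φ ; from-mono = from-mono φ }

⊕-cong : {X′ Y′ : RawLO} → X ≅ X′ → Y ≅ Y′ → (X ⊕ Y) ≅ (X′ ⊕ Y′)
⊕-cong {X} {Y} {X′} {Y′} φ ψ = record
  { to = t ; from = f ; to-from = t-f ; from-to = f-t
  ; to-mono = λ {u} {v} → t-mono {u} {v} ; from-mono = λ {u} {v} → f-mono {u} {v} }
  where
  t : Carrier (X ⊕ Y) → Carrier (X′ ⊕ Y′)
  t (inj₁ a) = inj₁ (to φ a)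
  t (inj₂ b) = inj₂ (to ψ b)
  f : Carrier (X′ ⊕ Y′) → Carrier (X ⊕ Y)
  f (inj₁ a) = inj₁ (from φ a)
  f (inj₂ b) = inj₂ (from ψ b)
  t-f : ∀ z → t (f z) ≡ z
  t-f (inj₁ a) = cong inj₁ (to-from φ a)
  t-f (inj₂ b) = cong inj₂ (to-from ψ b)
  f-t : ∀ z → f (t z) ≡ z
  f-t (inj₁ a) = cong inj₁ (from-to φ a)
  f-t (inj₂ b) = cong inj₂ (from-to ψ b)
  t-mono : ∀ {u v} → lt (X ⊕ Y) u v → lt (X′ ⊕ Y′) (t u) (t v)
  t-mono {inj₁ _} {inj₁ _} h = to-mono φ h
  t-mono {inj₁ _} {inj₂ _} _ = tt
  t-mono {inj₂ _} {inj₂ _} h = to-mono ψ h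
  f-mono : ∀ {u v} → lt (X′ ⊕ Y′) u v → lt (X ⊕ Y) (f u) (f v)
  f-mono {inj₁ _} {inj₁ _} h = from-mono φ h
  f-mono {inj₁ _} {inj₂ _} _ = tt
  f-mono {inj₂ _} {inj₂ _} h = from-mono ψ h

⊕-assoc : ((X ⊕ Y) ⊕ Z) ≅ (X ⊕ (Y ⊕ Z))
⊕-assoc {X} {Y} {Z} = record
  { to = t ; from = f ; to-from = t-f ; from-to = f-t
  ; to-mono = λ {u} {v} → t-mono {u} {v} ; from-mono = λ {u} {v} → f-mono {u} {v} }
  where
  t : Carrier ((X ⊕ Y) ⊕ Z) → Carrier (X ⊕ (Y ⊕ Z))
  t (inj₁ (inj₁ a)) = inj₁ a
  t (inj₁ (inj₂ b)) = inj₂ (inj₁ b)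
  t (inj₂ c) = inj₂ (inj₂ c)
  f : Carrier (X ⊕ (Y ⊕ Z)) → Carrier ((X ⊕ Y) ⊕ Z)
  f (inj₁ a) = inj₁ (inj₁ a)
  f (inj₂ (inj₁ b)) = inj₁ (inj₂ b)
  f (inj₂ (inj₂ c)) = inj₂ c
  t-f : ∀ z → t (f z) ≡ z
  t-f (inj₁ _) = refl
  t-f (inj₂ (inj₁ _)) = refl
  t-f (inj₂ (inj₂ _)) = refl
  f-t : ∀ z → f (t z) ≡ z
  f-t (inj₁ (inj₁ _)) = refl
  f-t (inj₁ (inj₂ _)) = refl
  f-t (inj₂ _) = refl
  t-mono : ∀ {u v} → lt ((X ⊕ Y) ⊕ Z) u v → lt (X ⊕ (Y ⊕ Z)) (t u) (t v)
  t-mono {inj₁ (inj₁ _)} {inj₁ (inj₁ _)} h = h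
  t-mono {inj₁ (inj₁ _)} {inj₁ (inj₂ _)} _ = tt
  t-mono {inj₁ (inj₁ _)} {inj₂ _} _ = tt
  t-mono {inj₁ (inj₂ _)} {inj₁ (inj₂ _)} h = h
  t-mono {inj₁ (inj₂ _)} {inj₂ _} _ = tt
  t-mono {inj₂ _} {inj₂ _} h = h
  f-mono : ∀ {u v} → lt (X ⊕ (Y ⊕ Z)) u v → lt ((X ⊕ Y) ⊕ Z) (f u) (f v)
  f-mono {inj₁ _} {inj₁ _} h = h
  f-mono {inj₁ _} {inj₂ (inj₁ _)} _ = tt
  f-mono {inj₁ _} {inj₂ (inj₂ _)} _ = tt
  f-mono {inj₂ (inj₁ _)} {inj₂ (inj₁ _)} h = h
  f-mono {inj₂ (inj₁ _)} {inj₂ (inj₂ _)} _ = tt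
  f-mono {inj₂ (inj₂ _)} {inj₂ (inj₂ _)} h = h

⊕-op : (X ⊕ Y) ᵒᵖ ≅ (Y ᵒᵖ ⊕ X ᵒᵖ)
⊕-op {X} {Y} = record
  { to = swap ; from = swap′ ; to-from = swap-swap′ ; from-to = swap′-swap
  ; to-mono = λ {u} {v} → swap-mono {u} {v} ; from-mono = λ {u} {v} → swap′-mono {u} {v} }
  where
  swap : Carrier (X ⊕ Y) → Carrier (Y ⊕ X)
  swap (inj₁ a) = inj₂ a
  swap (inj₂ b) = inj₁ b
  swap′ : Carrier (Y ⊕ X) → Carrier (X ⊕ Y)
  swap′ (inj₁ b) = inj₂ b
  swap′ (inj₂ a) = inj₁ a
  swap-swap′ : ∀ z → swap (swap′ z) ≡ z
  swap-swap′ (inj₁ _) = refl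
  swap-swap′ (inj₂ _) = refl
  swap′-swap : ∀ z → swap′ (swap z) ≡ z
  swap′-swap (inj₁ _) = refl
  swap′-swap (inj₂ _) = refl
  swap-mono : ∀ {u v} → lt ((X ⊕ Y) ᵒᵖ) u v → lt (Y ᵒᵖ ⊕ X ᵒᵖ) (swap u) (swap v)
  swap-mono {inj₁ _} {inj₁ _} h = h
  swap-mono {inj₂ _} {inj₁ _} _ = tt
  swap-mono {inj₂ _} {inj₂ _} h = h
  swap′-mono : ∀ {u v} → lt (Y ᵒᵖ ⊕ X ᵒᵖ) u v → lt ((X ⊕ Y) ᵒᵖ) (swap′ u) (swap′ v)
  swap′-mono {inj₁ _} {inj₁ _} h = h
  swap′-mono {inj₁ _} {inj₂ _} _ = tt
  swap′-mono {inj₂ _} {inj₂ _} h = h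

ΣFin-unfold : ∀ {n} {Ls : Fin (suc n) → RawLO} → ΣFin (suc n) Ls ≅ (Ls zero ⊕ ΣFin n (tail Ls))
ΣFin-unfold {n} {Ls} = record
  { to = t ; from = f ; to-from = t-f ; from-to = f-t ; to-mono = t-mono ; from-mono = f-mono }
  where
  t : Carrier (ΣFin (suc n) Ls) → Carrier (Ls zero ⊕ ΣFin n (tail Ls))
  t (zero , a) = inj₁ a
  t (suc k , a) = inj₂ (k , a)
  f : Carrier (Ls zero ⊕ ΣFin n (tail Ls)) → Carrier (ΣFin (suc n) Ls)
  f (inj₁ a) = zero , a
  f (inj₂ (k , a)) = suc k , a
  t-f : ∀ z → t (f z) ≡ z
  t-f (inj₁ _) = refl
  t-f (inj₂ _) = refl
  f-t : ∀ z → f (t z) ≡ z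
  f-t (zero , _) = refl
  f-t (suc _ , _) = refl
  t-mono : ∀ {u v} → FinLt (suc n) Ls u v → lt (Ls zero ⊕ ΣFin n (tail Ls)) (t u) (t v)
  t-mono {zero , _} {zero , _} (same h) = h
  t-mono {zero , _} {suc _ , _} _ = tt
  t-mono {suc _ , _} {suc _ , _} (diff (s≤s l)) = diff l
  t-mono {suc _ , _} {suc _ , _} (same h) = same h
  f-mono : ∀ {u v} → lt (Ls zero ⊕ ΣFin n (tail Ls)) u v → FinLt (suc n) Ls (f u) (f v)
  f-mono {inj₁ _} {inj₁ _} h = same h
  f-mono {inj₁ _} {inj₂ _} _ = diff z<s
  f-mono {inj₂ _} {inj₂ _} (diff l) = diff (s≤s l)
  f-mono {inj₂ _} {inj₂ _} (same h) = same h

Σω-unfold : Σω D ≅ (D 0 ⊕ Σω (λ i → D (suc i)))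
Σω-unfold {D} = record
  { to = t ; from = f ; to-from = t-f ; from-to = f-t ; to-mono = t-mono ; from-mono = f-mono }
  where
  t : Carrier (Σω D) → Carrier (D 0 ⊕ Σω (λ i → D (suc i)))
  t (zero , a) = inj₁ a
  t (suc k , a) = inj₂ (k , a)
  f : Carrier (D 0 ⊕ Σω (λ i → D (suc i))) → Carrier (Σω D)
  f (inj₁ a) = zero , a
  f (inj₂ (k , a)) = suc k , a
  t-f : ∀ z → t (f z) ≡ z
  t-f (inj₁ _) = refl
  t-f (inj₂ _) = refl
  f-t : ∀ z → f (t z) ≡ z
  f-t (zero , _) = refl
  f-t (suc _ , _) = refl
  t-mono : ∀ {u v} → ωLt D u v → lt (D 0 ⊕ Σω (λ i → D (suc i))) (t u) (t v)
  t-mono {zero , _} {zero , _} (same h) = h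
  t-mono {zero , _} {suc _ , _} _ = tt
  t-mono {suc _ , _} {suc _ , _} (diff (s≤s l)) = diff l
  t-mono {suc _ , _} {suc _ , _} (same h) = same h
  f-mono : ∀ {u v} → lt (D 0 ⊕ Σω (λ i → D (suc i))) u v → ωLt D (f u) (f v)
  f-mono {inj₁ _} {inj₁ _} h = same h
  f-mono {inj₁ _} {inj₂ _} _ = diff z<s
  f-mono {inj₂ _} {inj₂ _} (diff l) = diff (s≤s l)
  f-mono {inj₂ _} {inj₂ _} (same h) = same h

Σω*-dual : Σω* C ᵒᵖ ≅ Σω (λ i → C i ᵒᵖ)
Σω*-dual {C} = record
  { to = λ p → p ; from = λ p → p ; to-from = λ _ → refl ; from-to = λ _ → refl
  ; to-mono = t-mono ; from-mono = f-mono }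
  where
  t-mono : ∀ {p q} → ω*Lt C q p → ωLt (λ i → C i ᵒᵖ) p q
  t-mono (diff l) = diff l
  t-mono (same h) = same h
  f-mono : ∀ {p q} → ωLt (λ i → C i ᵒᵖ) p q → ω*Lt C q p
  f-mono (diff l) = diff l
  f-mono (same h) = same h

Σω*-unfold : Σω* D ≅ (Σω* (λ i → D (suc i)) ⊕ D 0)
Σω*-unfold {D} = begin
  Σω* D                                         ≈⟨ ≅-op Σω*-dual ⟩
  Σω (λ i → D i ᵒᵖ) ᵒᵖ                          ≈⟨ ≅-op Σω-unfold ⟩
  (D 0 ᵒᵖ ⊕ Σω (λ i → D (suc i) ᵒᵖ)) ᵒᵖ        ≈⟨ ⊕-op ⟩
  (Σω (λ i → D (suc i) ᵒᵖ) ᵒᵖ ⊕ D 0)            ≈⟨ ⊕-cong (≅-op Σω*-dual) ≅-refl ⟨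
  (Σω* (λ i → D (suc i)) ⊕ D 0)                 ∎
  where open SetoidReasoning ≅-setoid

point : H M → Carrier M
point (one φ) = from φ tt
point (ωs C hC _ φ) = from φ (0 , point (hC 0))
point (ω*s C hC _ φ) = from φ (0 , point (hC 0))

H-irrefl : H M → ∀ x → ¬ lt M x x
H-irrefl (one φ) x x<x = to-mono φ x<x
H-irrefl (ωs C hC _ φ) x x<x = irrefl (to φ x) (to-mono φ x<x)
  where
  irrefl : ∀ p → ¬ ωLt C p p
  irrefl _ (diff l) = <-irrefl refl l
  irrefl (i , a) (same h) = H-irrefl (hC i) a h
H-irrefl (ω*s C hC _ φ) x x<x = irrefl (to φ x) (to-mono φ x<x)
  where
  irrefl : ∀ p → ¬ ω*Lt C p p
  irrefl _ (diff l) = <-irrefl refl l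
  irrefl (i , a) (same h) = H-irrefl (hC i) a h

Star-op : Star C → Star (λ i → C i ᵒᵖ)
Star-op st i n = let (j , n≤j , e) = st i n in j , n≤j , ↪-op e

inBlock : ∀ j → C j ↪ Σω C
inBlock j = record { fun = j ,_ ; mono = same }

block-mono : ∀ {p q} → ωLt C p q → proj₁ p ≤ proj₁ q
block-mono (diff l) = <⇒≤ l
block-mono (same _) = ≤-refl

-- Using (*) repeatedly, block i of Σω C embeds into a block `target i`, with
-- n ≤ target 0 < target 1 < ⋯ .  This gives a self-embedding `shift` of Σω C
-- whose image lies in the blocks from n on.
module Shift (st : Star C) (n : ℕ) where

  target : ℕ → ℕ
  target zero = proj₁ (st 0 n)
  target (suc i) = proj₁ (st (suc i) (suc (target i)))

  embed : ∀ i → C i ↪ C (target i)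
  embed zero = proj₂ (proj₂ (st 0 n))
  embed (suc i) = proj₂ (proj₂ (st (suc i) (suc (target i))))

  target-step : ∀ i → target i < target (suc i)
  target-step i = proj₁ (proj₂ (st (suc i) (suc (target i))))

  target-mono : ∀ {i j} → i < j → target i < target j
  target-mono = go ∘ ≤⇒≤′
    where
    go : ∀ {i j} → suc i ≤′ j → target i < target j
    go ≤′-refl = target-step _
    go (≤′-step i<j) = <-trans (go i<j) (target-step _)

  target-≥ : ∀ i → n ≤ target i
  target-≥ zero = proj₁ (proj₂ (st 0 n))
  target-≥ (suc i) = ≤-trans (target-≥ i) (<⇒≤ (target-step i))

  shift-fun : Carrier (Σω C) → Carrier (Σω C)
  shift-fun (i , a) = target i , fun (embed i) a

  shift : Σω C ↪ Σω C
  shift = record { fun = shift-fun ; mono = shift-mono }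
    where
    shift-mono : ∀ {p q} → ωLt C p q → ωLt C (shift-fun p) (shift-fun q)
    shift-mono (diff l) = diff (target-mono l)
    shift-mono {i , _} (same h) = same (mono (embed i) h)

-- A self-embedding of M mapping all of M strictly above the point y.
-- `Above (M ᵒᵖ) y` is then a self-embedding mapping M strictly below y.
Above : (M : RawLO) → Carrier M → Set
Above M y = Σ (M ↪ M) (λ f → ∀ x → lt M y (fun f x))

Rigid : RawLO → Set
Rigid M = ∀ y → Above M y → Above (M ᵒᵖ) y → ⊥

Rigid-op : Rigid M → Rigid (M ᵒᵖ)
Rigid-op rigid y above below = rigid y below above

Above-push : (φ : M ≅ N) {y : Carrier M} → Above M y → Above N (to φ y)
Above-push φ (f , above) = ≅⇒↪ φ ∘ₑ (f ∘ₑ ≅⇒↪ (≅-sym φ)) , λ b → to-mono φ (above (from φ b))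

Above-pull : (φ : M ≅ N) {y : Carrier M} → Above N (to φ y) → Above M y
Above-pull {M} φ {y} above = subst (Above M) (from-to φ y) (Above-push (≅-sym φ) above)

Σω-above : Star C → ∀ y → Above (Σω C) y
Σω-above st (i , _) = shift , λ (j , _) → diff (target-≥ j)
  where open Shift st (suc i)

into-block : ∀ j (f : X ↪ Σω C) → (∀ x → proj₁ (fun f x) ≡ j) → X ↪ C j
into-block {X} {C} j f in-j = record
  { fun = λ x → component (fun f x) (in-j x)
  ; mono = λ {x} {x′} h → component-mono (in-j x) (in-j x′) (mono f h) }
  where
  component : (p : Carrier (Σω C)) → proj₁ p ≡ j → Carrier (C j)
  component (_ , a) refl = a
  component-mono : ∀ {p q} (p-in : proj₁ p ≡ j) (q-in : proj₁ q ≡ j) → ωLt C p q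
    → lt (C j) (component p p-in) (component q q-in)
  component-mono refl refl (diff l) = ⊥-elim (<-irrefl refl l)
  component-mono refl refl (same h) = h

-- If an ω-sum satisfying (*) embeds into none of its blocks, then no
-- self-embedding stays within the blocks 0, …, k: descending on k, a
-- self-embedding f that reaches block k+1 at a point p stays in block k+1
-- on the part shifted above p, which would embed Σω C into block k+1.
module _ (st : Star C) (no-block : ∀ j → ¬ (Σω C ↪ C j)) where

  Σω-unbounded : ∀ k (f : Σω C ↪ Σω C) → ¬ (∀ p → proj₁ (fun f p) ≤ k)
  Σω-unbounded zero f ≤0 = no-block 0 (into-block 0 f (λ p → n≤0⇒n≡0 (≤0 p)))
  Σω-unbounded (suc k) f ≤k+1 =
    Σω-unbounded k f (λ p → m<1+n⇒m≤n (≤∧≢⇒< (≤k+1 p) (misses-top p)))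
    where
    misses-top : ∀ p → proj₁ (fun f p) ≢ suc k
    misses-top (i , _) reaches = no-block (suc k) (into-block (suc k) (f ∘ₑ shift) stays)
      where
      open Shift st (suc i)
      stays : ∀ q → proj₁ (fun f (fun shift q)) ≡ suc k
      stays q = ≤-antisym (≤k+1 _)
        (subst (_≤ proj₁ (fun f (fun shift q))) reaches (block-mono (mono f (diff (target-≥ (proj₁ q))))))

  Σω-not-below : ∀ y → ¬ Above (Σω C ᵒᵖ) y
  Σω-not-below y (f , below) = Σω-unbounded (proj₁ y) (↪-op f) (λ p → block-mono (below p))

-- If all blocks of Σω C are nonempty and rigid, Σω C embeds into none of
-- them: from h : Σω C ↪ C j, block j shifts C j below y = h(j+1, _), and
-- by (*) a later block shifts C j above y.
Σω-no-block-embedding : Star C → (∀ i → Carrier (C i)) → (∀ i → Rigid (C i)) → ∀ j → ¬ (Σω C ↪ C j)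
Σω-no-block-embedding {C} st pt rigid j h = rigid j y above below
  where
  y : Carrier (C j)
  y = fun h (suc j , pt (suc j))
  later : Σ ℕ (λ k → (suc (suc j) ≤ k) × (C j ↪ C k))
  later = st j (suc (suc j))
  above : Above (C j) y
  above = h ∘ₑ (inBlock (proj₁ later) ∘ₑ proj₂ (proj₂ later)) , λ _ → mono h (diff (proj₁ (proj₂ later)))
  below : Above (C j ᵒᵖ) y
  below = ↪-op (h ∘ₑ inBlock j) , λ _ → mono h (diff (n<1+n j))

H-rigid : H M → Rigid M
H-rigid (one φ) y (_ , above) _ = to-mono φ (above y)
H-rigid (ωs C hC st φ) y _ below =
  Σω-not-below st (Σω-no-block-embedding st (λ i → point (hC i)) (λ i → H-rigid (hC i)))
    (to φ y) (Above-push (≅-op φ) below)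
H-rigid {M} (ω*s C hC st φ) y above _ =
  Σω-not-below (Star-op st) (Σω-no-block-embedding (Star-op st) (λ i → point (hC i)) (λ i → Rigid-op (H-rigid (hC i))))
    (to reversed y) (Above-push (≅-op reversed) above)
  where
  reversed : M ᵒᵖ ≅ Σω (λ i → C i ᵒᵖ)
  reversed = ≅-trans (≅-op φ) Σω*-dual

-- An ω*-sum shifts below any point and an ω-sum above any point, so by
-- rigidity no member of H is both.
ω*-sum-not-ω-sum : ∀ L → H L → Isω*Sum L → IsωSum L → ⊥
ω*-sum-not-ω-sum L hL (A , _ , stA , ψ) (B , _ , stB , φ) = H-rigid hL y above below
  where
  y : Carrier L
  y = point hL
  above : Above L y
  above = Above-pull φ (Σω-above stB (to φ y))
  below : Above (L ᵒᵖ) y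
  below = Above-pull (≅-trans (≅-op ψ) Σω*-dual) (Σω-above (Star-op stA) _)

singleton-collapse : Singleton M → M ≅ N → (p q : Carrier N) → p ≡ q
singleton-collapse (_ , unique) φ p q = begin
  p                ≡⟨ to-from φ p ⟨
  to φ (from φ p)  ≡⟨ cong (to φ) (trans (unique _) (sym (unique _))) ⟩
  to φ (from φ q)  ≡⟨ to-from φ q ⟩
  q                ∎
  where open ≡-Reasoning

two-blocks : (∀ i → H (C i)) → ¬ (∀ (p q : Σ ℕ (λ i → Carrier (C i))) → p ≡ q)
two-blocks hC all-equal with cong proj₁ (all-equal (0 , point (hC 0)) (1 , point (hC 1)))
... | ()

H-trichotomy : H M → ExactlyOne (Singleton M) (IsωSum M) (Isω*Sum M)
H-trichotomy {M} hM =
    shape hM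
  , (λ (s , (_ , hC , _ , φ)) → two-blocks hC (singleton-collapse s φ))
  , (λ (s , (_ , hC , _ , φ)) → two-blocks hC (singleton-collapse s φ))
  , (λ (ω , ω*) → ω*-sum-not-ω-sum M hM ω* ω)
  where
  shape : H M → Singleton M ⊎ IsωSum M ⊎ Isω*Sum M
  shape (one φ) = inj₁ (from φ tt , λ x → sym (from-to φ x))
  shape (ωs C hC st φ) = inj₂ (inj₁ (C , hC , st , φ))
  shape (ω*s C hC st φ) = inj₂ (inj₂ (C , hC , st , φ))

adjacent : ∀ {m} (i j : Fin (suc m)) → toℕ j ≡ suc (toℕ i) → Σ (Fin m) (λ k → i ≡ inject₁ k × j ≡ suc k)
adjacent {suc m} zero (suc zero) refl = zero , refl , refl
adjacent {suc m} (suc i) (suc j) j≡i+1 with adjacent i j (suc-injective j≡i+1)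
... | k , refl , refl = suc k , refl , refl
adjacent {zero} zero zero ()
adjacent {suc m} zero zero ()
adjacent {suc m} zero (suc (suc _)) ()

merge : ∀ {m} → (Fin (suc m) → RawLO) → Fin m → Fin m → RawLO
merge Ls zero = (Ls zero ⊕ Ls (suc zero)) ∷ tail (tail Ls)
merge Ls (suc k) = Ls zero ∷ merge (tail Ls) k

merge-H : ∀ {m} {Ls : Fin (suc m) → RawLO} (k : Fin m) → (∀ l → H (Ls l))
  → H (Ls (inject₁ k) ⊕ Ls (suc k)) → ∀ l → H (merge Ls k l)
merge-H zero _ hk zero = hk
merge-H zero hLs _ (suc l) = hLs (suc (suc l))
merge-H (suc k) hLs _ zero = hLs zero
merge-H (suc k) hLs hk (suc l) = merge-H k (λ l → hLs (suc l)) hk l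

merge-≅ : ∀ {m} (Ls : Fin (suc m) → RawLO) (k : Fin m) → ΣFin (suc m) Ls ≅ ΣFin m (merge Ls k)
merge-≅ {suc m} Ls zero = begin
  ΣFin (suc (suc m)) Ls                              ≈⟨ ΣFin-unfold ⟩
  (Ls zero ⊕ ΣFin (suc m) (tail Ls))                ≈⟨ ⊕-cong ≅-refl ΣFin-unfold ⟩
  (Ls zero ⊕ (Ls (suc zero) ⊕ ΣFin m (tail (tail Ls)))) ≈⟨ ⊕-assoc ⟨
  ((Ls zero ⊕ Ls (suc zero)) ⊕ ΣFin m (tail (tail Ls))) ≈⟨ ΣFin-unfold ⟨
  ΣFin (suc m) (merge Ls zero)                       ∎
  where open SetoidReasoning ≅-setoid
merge-≅ {suc m} Ls (suc k) = begin
  ΣFin (suc (suc m)) Ls                      ≈⟨ ΣFin-unfold ⟩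
  (Ls zero ⊕ ΣFin (suc m) (tail Ls))        ≈⟨ ⊕-cong ≅-refl (merge-≅ (tail Ls) k) ⟩
  (Ls zero ⊕ ΣFin m (merge (tail Ls) k))    ≈⟨ ΣFin-unfold ⟨
  ΣFin (suc m) (merge Ls (suc k))            ∎
  where open SetoidReasoning ≅-setoid

-- In a decomposition of L into the least possible number of members of H,
-- no two adjacent summands add up to a member of H: otherwise merging them
-- would give a shorter decomposition.
adjacent-sum-not-H : ∀ {L m} {Ls : Fin m → RawLO} → L ≅ ΣFin m Ls → (∀ i → H (Ls i))
  → (∀ n → n < m → ¬ SumOfH L n) → ∀ i j → toℕ j ≡ suc (toℕ i) → ¬ H (Ls i ⊕ Ls j)
adjacent-sum-not-H {m = suc m} {Ls} φ hLs minimal i j j≡i+1 hij with adjacent i j j≡i+1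
... | k , refl , refl = minimal m (n<1+n m) (merge Ls k , merge-H k hLs hij , ≅-trans φ (merge-≅ Ls k))

_∷ω_ : RawLO → (ℕ → RawLO) → ℕ → RawLO
(X ∷ω C) zero = X
(X ∷ω C) (suc i) = C i

-- Putting a singleton member X of H in front of a sequence satisfying (*)
-- preserves (*): X embeds into any block since X has no two related points.
Star-∷ω : H X → Singleton X → (∀ i → H (C i)) → Star C → Star (X ∷ω C)
Star-∷ω {X} {C} hX (x , unique) hC st zero n = suc n , n≤1+n n , constant
  where
  constant : X ↪ C n
  constant = record
    { fun = λ _ → point (hC n)
    ; mono = λ {a} {b} a<b → ⊥-elim (H-irrefl hX x (subst₂ (lt X) (unique a) (unique b) a<b)) }
Star-∷ω _ _ _ st (suc i) n =
  let (j , n≤j , e) = st i n in suc j , ≤-trans n≤j (n≤1+n j) , e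

∷ω-H : H X → (∀ i → H (C i)) → ∀ i → H ((X ∷ω C) i)
∷ω-H hX _ zero = hX
∷ω-H _ hC (suc i) = hC i

singleton-⊕-ω-sum : H X → Singleton X → IsωSum Y → H (X ⊕ Y)
singleton-⊕-ω-sum hX s (C , hC , st , φ) =
  ωs (_ ∷ω C) (∷ω-H hX hC) (Star-∷ω hX s hC st) (≅-trans (⊕-cong ≅-refl φ) (≅-sym Σω-unfold))

ω*-sum-⊕-singleton : H X → Singleton X → Isω*Sum Y → H (Y ⊕ X)
ω*-sum-⊕-singleton hX s (C , hC , st , φ) =
  ω*s (_ ∷ω C) (∷ω-H hX hC) (Star-∷ω hX s hC st) (≅-trans (⊕-cong φ ≅-refl) (≅-sym Σω*-unfold))

singleton-neighbours : ∀ {m} {Ls : Fin m → RawLO} → (∀ i → H (Ls i))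
  → (∀ i j → toℕ j ≡ suc (toℕ i) → ¬ H (Ls i ⊕ Ls j))
  → ∀ i → Singleton (Ls i)
  → (∀ j → toℕ j ≡ suc (toℕ i) → ¬ IsωSum (Ls j)) × (∀ j → suc (toℕ j) ≡ toℕ i → ¬ Isω*Sum (Ls j))
singleton-neighbours hLs not-H i s =
    (λ j j≡i+1 ω → not-H i j j≡i+1 (singleton-⊕-ω-sum (hLs i) s ω))
  , (λ j i≡j+1 ω* → not-H j i (sym i≡j+1) (ω*-sum-⊕-singleton (hLs i) s ω*))

-- Lemma 6.1: part (a) is ω*-sum-not-ω-sum; part (b) collects the three
-- facts about the summands of a minimal decomposition.
lemma6p1 : (∀ (L : RawLO) → H L → Isω*Sum L → IsωSum L → ⊥)
    × (∀ (m : ℕ) (L : RawLO) → CSₘ m L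
        → (Ls : Fin m → RawLO) → (∀ i → H (Ls i)) → L ≅ ΣFin m Ls
        → (∀ i → ExactlyOne (Singleton (Ls i)) (IsωSum (Ls i)) (Isω*Sum (Ls i)))
          × (∀ (i j : Fin m) → toℕ j ≡ suc (toℕ i) → ¬ H (Ls i ⊕ Ls j))
          × (∀ i → Singleton (Ls i)
              → (∀ (j : Fin m) → toℕ j ≡ suc (toℕ i) → ¬ IsωSum (Ls j))
                × (∀ (j : Fin m) → suc (toℕ j) ≡ toℕ i → ¬ Isω*Sum (Ls j))))
lemma6p1 = ω*-sum-not-ω-sum , λ m L (_ , _ , minimal) Ls hLs φ →
    (λ i → H-trichotomy (hLs i))
  , adjacent-sum-not-H φ hLs minimal
  , singleton-neighbours hLs (adjacent-sum-not-H φ hLs minimal)
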